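{- Let $p\ge 5$ be a prime such that $X^3-X-1$ has three distinct roots $\alpha,\beta,\gamma$ in $\mathbb{F}_p$, and let $N_p=\min\{|\alpha/\beta|,|\beta/\gamma|,|\gamma/\alpha|\}$, where $|x|$ is the multiplicative order of $x\in\mathbb{F}_p^*$. Let $(a_n)_{n\in\mathbb{Z}}$ be a complete Padovan sequence in $\mathbb{F}_p$ with initial values $(1,b,c)$, and assume $\gamma^2 b+\gamma c+1=0$, so that $a_n=A\alpha^n+B\beta^n$ for all $n$, where $A=\frac{\alpha^2 b+\alpha c+1}{2\alpha+3}$ and $B=\frac{\beta^2 b+\beta c+1}{2\beta+3}$. For $k\ge 0$ let $I_k=\{j\in\mathbb{Z} : 0\le j\le k,\ \alpha^j\beta^{k-j}=1 \text{ in } \mathbb{F}_p\}$, let $k_{\min}$ be the smallest $k\ge 1$ with $I_k\neq\varnothing$, and let $j_0=\min(I_{k_{\min}})$. If $p\le N_p^2+1$, then $I_{k_{\min}}=\{j_0\}$.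
   Context: A complete Padovan sequence in $\mathbb{F}_p$ is a sequence $(a_n)_{n\in\mathbb{Z}}$ in $\mathbb{F}_p$ with $a_0=1$, $a_{n+3}=a_n+a_{n+1}$ for all $n$, periodic with period $p-1$, and with $\{a_1,\dots,a_{p-2}\}=\{2,\dots,p-1\}$. -}

module Defs where

open import Data.Nat as ℕ using (ℕ; zero; suc; _∸_)
open import Data.Integer as ℤ using (ℤ; +_; _+_; _-_; _*_; _^_)
open import Data.Integer.Divisibility using (_∣_)
open import Data.Product using (Σ; _×_; ∃; ∃-syntax)
open import Relation.Nullary using (¬_)

-- Elements of 𝔽_p are represented by integers; equality in 𝔽_p is
-- congruence modulo p.
_≡_[mod_] : ℤ → ℤ → ℕ → Set
x ≡ y [mod p ] = (+ p) ∣ (x - y)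

infix 4 _≡_[mod_]

IsRootPadovanPoly : ℕ → ℤ → Set
IsRootPadovanPoly p x = x ^ 3 ≡ x + + 1 [mod p ]

IsMultOrder : ℕ → ℤ → ℕ → Set
IsMultOrder p x m =
  (1 ℕ.≤ m) × (x ^ m ≡ + 1 [mod p ]) ×
  (∀ m' → 1 ℕ.≤ m' → m' ℕ.< m → ¬ (x ^ m' ≡ + 1 [mod p ]))

-- m is the multiplicative order of the quotient x / y in 𝔽_p^* (y ≠ 0):
-- for every representative r of x / y (i.e. r * y = x in 𝔽_p), m is the order of r.
IsOrderOfQuotient : ℕ → ℤ → ℤ → ℕ → Set
IsOrderOfQuotient p x y m = ∀ r → r * y ≡ x [mod p ] → IsMultOrder p r m

record CompletePadovan (p : ℕ) (a : ℤ → ℤ) : Set where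
  field
    init      : a (+ 0) ≡ + 1 [mod p ]
    recur     : ∀ n → a (n + + 3) ≡ a n + a (n + + 1) [mod p ]
    periodic  : ∀ n → a (n + + (p ∸ 1)) ≡ a n [mod p ]
    values⊆   : ∀ i → 1 ℕ.≤ i → i ℕ.≤ p ∸ 2 →
                ∃[ v ] (2 ℕ.≤ v × v ℕ.≤ p ∸ 1 × a (+ i) ≡ + v [mod p ])
    values⊇   : ∀ v → 2 ℕ.≤ v → v ℕ.≤ p ∸ 1 →
                ∃[ i ] (1 ℕ.≤ i × i ℕ.≤ p ∸ 2 × a (+ i) ≡ + v [mod p ])

InI : ℕ → ℤ → ℤ → ℕ → ℕ → Set
InI p α β k j = (j ℕ.≤ k) × (α ^ j * β ^ (k ∸ j) ≡ + 1 [mod p ])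

INonempty : ℕ → ℤ → ℤ → ℕ → Set
INonempty p α β k = ∃[ j ] InI p α β k j

IsKmin : ℕ → ℤ → ℤ → ℕ → Set
IsKmin p α β kmin =
  (1 ℕ.≤ kmin) × INonempty p α β kmin ×
  (∀ k → 1 ℕ.≤ k → k ℕ.< kmin → ¬ INonempty p α β k)

IsMinOfI : ℕ → ℤ → ℤ → ℕ → ℕ → Set
IsMinOfI p α β k j0 = InI p α β k j0 × (∀ j → InI p α β k j → j0 ℕ.≤ j)

{-# OPTIONS --safe #-}
module Submission where

-- Write ρ for the class of α/β in 𝔽_p, so that α^j β^(k−j) = ρ^j β^k and m is the order of ρ.
-- If j₀ < j both lie in I_k then ρ^(j−j₀) = 1, so j₀ + m ≤ k. Minimality of k then gives
-- β^d ∉ ⟨ρ⟩ for 0 < d < k (otherwise I_d or I_(k−d) would be nonempty), so the k cosets β^s⟨ρ⟩,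
-- 0 ≤ s < k, are disjoint and k m ≤ p − 1 ≤ m², i.e. k ≤ m. Hence j₀ = 0 and k = m, so ρ and β
-- are k-th roots of unity and the k m elements ρ^t β^s are distinct roots of X^k − 1, giving
-- k m ≤ k against m ≥ 2. Only the root β, the order of α/β and the bound on p enter.

open import Data.Empty using (⊥-elim)
open import Data.Fin as Fin using (Fin; toℕ; fromℕ<)
import Data.Fin.Properties as Fin
open import Data.Integer as ℤ using (ℤ; +_)
open import Data.Integer.DivMod using (_%ℕ_; _/ℕ_; n%ℕd<d; a≡a%ℕn+[a/ℕn]*n)
open import Data.Integer.Divisibility.Signed
  using (_∣_; divides; ∣ᵤ⇒∣; ∣⇒∣ᵤ; ∣m⇒∣-m; ∣m∣n⇒∣m+n; ∣m∣n⇒∣m-n; ∣n⇒∣m*n; ∣m⇒∣m*n)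
import Data.Integer.Properties as ℤ
open import Algebra.Properties.CommutativeSemigroup ℤ.*-commutativeSemigroup using (interchange)
open import Data.Integer.Tactic.RingSolver using (solve-∀)
open import Data.Nat as ℕ using (ℕ; zero; suc; _≤_; _<_; _∸_; z≤n; s≤s; nonTrivial⇒≢1)
import Data.Nat.Divisibility as ℕ
open import Data.Nat.DivMod using (_%_; _/_; m%n<n; m≡m%n+[m/n]*n)
open import Data.Nat.Primality using (Prime; euclidsLemma; prime⇒nonZero; prime⇒nonTrivial)
import Data.Nat.Properties as ℕ
open import Data.Product using (_×_; _,_; proj₁; proj₂; ∃-syntax; uncurry)
open import Data.Sum using (_⊎_; inj₁; inj₂)
open import Data.Vec using (Vec; []; _∷_; replicate)
open import Function.Base using (_∘_)
open import Function.Definitions using (Injective)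
open import Relation.Binary.Bundles using (Setoid)
open import Relation.Binary.Definitions using (tri<; tri≈; tri>)
open import Relation.Binary.PropositionalEquality
  using (_≡_; refl; sym; trans; cong; cong₂; subst; subst₂; module ≡-Reasoning)
import Relation.Binary.Reasoning.Setoid as SetoidReasoning
open import Relation.Nullary using (¬_; yes; no; contradiction)

open import Defs

module IntegerAlgebra where

  open import Data.Integer using (_+_; _-_; _*_; _^_)

  ^-distribʳ-* : ∀ x y n → (x * y) ^ n ≡ x ^ n * y ^ n
  ^-distribʳ-* x y zero    = refl
  ^-distribʳ-* x y (suc n) = begin
    (x * y) * (x * y) ^ n     ≡⟨ cong ((x * y) *_) (^-distribʳ-* x y n) ⟩
    (x * y) * (x ^ n * y ^ n) ≡⟨ interchange x y (x ^ n) (y ^ n) ⟩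
    (x * x ^ n) * (y * y ^ n) ∎
    where open ≡-Reasoning

  ^-^-comm : ∀ x a b → (x ^ a) ^ b ≡ (x ^ b) ^ a
  ^-^-comm x a b = trans (ℤ.^-*-assoc x a b) (trans (cong (x ^_) (ℕ.*-comm a b)) (sym (ℤ.^-*-assoc x b a)))

  monic : ∀ {d} → Vec ℤ d → ℤ → ℤ
  monic []       x = + 1
  monic (c ∷ cs) x = c + x * monic cs x

  deflate : ∀ {d} → ℤ → Vec ℤ (suc d) → Vec ℤ d
  deflate r (c ∷ [])      = []
  deflate r (c ∷ c′ ∷ cs) = monic (c′ ∷ cs) r ∷ deflate r (c′ ∷ cs)

  monic-factor : ∀ {d} r (cs : Vec ℤ (suc d)) x →
                 monic cs x - monic cs r ≡ (x - r) * monic (deflate r cs) x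
  monic-factor r (c ∷ []) x = lemma c x r
    where lemma : ∀ c x r → (c + x * + 1) - (c + r * + 1) ≡ (x - r) * + 1
          lemma = solve-∀
  monic-factor r (c ∷ c′ ∷ cs) x = begin
    (c + x * F x) - (c + r * F r)                 ≡⟨ cong (λ y → (c + x * y) - (c + r * F r)) F-expand ⟩
    (c + x * (F r + (x - r) * Q)) - (c + r * F r) ≡⟨ lemma c x r (F r) Q ⟩
    (x - r) * (F r + x * Q)                       ∎
    where
      open ≡-Reasoning
      F : ℤ → ℤ
      F = monic (c′ ∷ cs)
      Q : ℤ
      Q = monic (deflate r (c′ ∷ cs)) x
      F-expand : F x ≡ F r + (x - r) * Q
      F-expand = trans (sym (add-difference (F r) (F x))) (cong (λ y → F r + y) (monic-factor r (c′ ∷ cs) x))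
        where add-difference : ∀ a b → a + (b - a) ≡ b
              add-difference = solve-∀
      lemma : ∀ c x r Fr Q → (c + x * (Fr + (x - r) * Q)) - (c + r * Fr) ≡ (x - r) * (Fr + x * Q)
      lemma = solve-∀

  monic-zeros : ∀ d x → monic (replicate d (+ 0)) x ≡ x ^ d
  monic-zeros zero    x = refl
  monic-zeros (suc d) x = trans (ℤ.+-identityˡ _) (cong (x *_) (monic-zeros d x))

module Congruence (p : ℕ) where

  open import Data.Integer using (_+_; _-_; _*_; _^_; -_)
  open IntegerAlgebra

  infix 4 _≈_ _≉_

  -- A record rather than the divisibility itself, so that x and y can be inferred from x ≈ y.
  record _≈_ (x y : ℤ) : Set where
    constructor congruent
    field p∣x-y : + p ∣ x - y

  open _≈_ public

  _≉_ : ℤ → ℤ → Set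
  x ≉ y = ¬ x ≈ y

  ≡[mod]⇒≈ : ∀ {x y} → x ≡ y [mod p ] → x ≈ y
  ≡[mod]⇒≈ h = congruent (∣ᵤ⇒∣ h)

  ≈⇒≡[mod] : ∀ {x y} → x ≈ y → x ≡ y [mod p ]
  ≈⇒≡[mod] (congruent h) = ∣⇒∣ᵤ h

  congruent-by : ∀ {x y z} → z ≡ x - y → + p ∣ z → x ≈ y
  congruent-by refl h = congruent h

  ≈-refl : ∀ {x} → x ≈ x
  ≈-refl {x} = congruent-by (sym (ℤ.+-inverseʳ x)) (divides (+ 0) refl)

  ≈-sym : ∀ {x y} → x ≈ y → y ≈ x
  ≈-sym {x} {y} (congruent h) = congruent-by (lemma x y) (∣m⇒∣-m h)
    where lemma : ∀ x y → - (x - y) ≡ y - x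
          lemma = solve-∀

  ≈-trans : ∀ {x y z} → x ≈ y → y ≈ z → x ≈ z
  ≈-trans {x} {y} {z} (congruent h) (congruent h′) = congruent-by (lemma x y z) (∣m∣n⇒∣m+n h h′)
    where lemma : ∀ x y z → (x - y) + (y - z) ≡ x - z
          lemma = solve-∀

  ≈-setoid : Setoid _ _
  ≈-setoid = record
    { _≈_ = _≈_
    ; isEquivalence = record { refl = ≈-refl ; sym = ≈-sym ; trans = ≈-trans } }

  +-cong : ∀ {x y u v} → x ≈ y → u ≈ v → x + u ≈ y + v
  +-cong {x} {y} {u} {v} (congruent h) (congruent h′) = congruent-by (lemma x y u v) (∣m∣n⇒∣m+n h h′)
    where lemma : ∀ x y u v → (x - y) + (u - v) ≡ (x + u) - (y + v)
          lemma = solve-∀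

  sub-cong : ∀ {x y u v} → x ≈ y → u ≈ v → x - u ≈ y - v
  sub-cong {x} {y} {u} {v} (congruent h) (congruent h′) = congruent-by (lemma x y u v) (∣m∣n⇒∣m-n h h′)
    where lemma : ∀ x y u v → (x - y) - (u - v) ≡ (x - u) - (y - v)
          lemma = solve-∀

  *-cong : ∀ {x y u v} → x ≈ y → u ≈ v → x * u ≈ y * v
  *-cong {x} {y} {u} {v} (congruent h) (congruent h′) =
    congruent-by (lemma x y u v) (∣m∣n⇒∣m+n (∣m⇒∣m*n u h) (∣n⇒∣m*n y h′))
    where lemma : ∀ x y u v → (x - y) * u + y * (u - v) ≡ x * u - y * v
          lemma = solve-∀

  *-congˡ : ∀ x {y z} → y ≈ z → x * y ≈ x * z
  *-congˡ x = *-cong (≈-refl {x})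

  *-congʳ : ∀ z {x y} → x ≈ y → x * z ≈ y * z
  *-congʳ z h = *-cong h (≈-refl {z})

  ^-congˡ : ∀ {x y} n → x ≈ y → x ^ n ≈ y ^ n
  ^-congˡ zero    _ = ≈-refl
  ^-congˡ (suc n) h = *-cong h (^-congˡ n h)

  ≈0⇒∣ : ∀ {x} → x ≈ + 0 → + p ∣ x
  ≈0⇒∣ {x} (congruent h) = subst (+ p ∣_) (ℤ.+-identityʳ x) h

  ∣⇒≈0 : ∀ {x} → + p ∣ x → x ≈ + 0
  ∣⇒≈0 {x} h = congruent-by (sym (ℤ.+-identityʳ x)) h

  x-y≈0⇒x≈y : ∀ {x y} → x - y ≈ + 0 → x ≈ y
  x-y≈0⇒x≈y h = congruent (≈0⇒∣ h)

  module PrimeModulus (prime : Prime p) where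

    1≉0 : + 1 ≉ + 0
    1≉0 h = nonTrivial⇒≢1 {{prime⇒nonTrivial prime}} (ℕ.∣1⇒≡1 (∣⇒∣ᵤ (≈0⇒∣ h)))

    x*y≈0⇒x≈0∨y≈0 : ∀ x y → x * y ≈ + 0 → x ≈ + 0 ⊎ y ≈ + 0
    x*y≈0⇒x≈0∨y≈0 x y h
      with euclidsLemma ℤ.∣ x ∣ ℤ.∣ y ∣ prime (subst (p ℕ.∣_) (ℤ.abs-* x y) (∣⇒∣ᵤ (≈0⇒∣ h)))
    ... | inj₁ p∣x = inj₁ (∣⇒≈0 (∣ᵤ⇒∣ p∣x))
    ... | inj₂ p∣y = inj₂ (∣⇒≈0 (∣ᵤ⇒∣ p∣y))

    *-≉0 : ∀ {x y} → x ≉ + 0 → y ≉ + 0 → x * y ≉ + 0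
    *-≉0 {x} {y} x≉0 y≉0 h with x*y≈0⇒x≈0∨y≈0 x y h
    ... | inj₁ x≈0 = x≉0 x≈0
    ... | inj₂ y≈0 = y≉0 y≈0

    ^-≉0 : ∀ {x} n → x ≉ + 0 → x ^ n ≉ + 0
    ^-≉0 zero    _   = 1≉0
    ^-≉0 (suc n) x≉0 = *-≉0 x≉0 (^-≉0 n x≉0)

    x^n≈1⇒x≉0 : ∀ {x} n → 1 ≤ n → x ^ n ≈ + 1 → x ≉ + 0
    x^n≈1⇒x≉0 {x} (suc n) _ h x≈0 = 1≉0 (begin
      + 1         ≈⟨ ≈-sym h ⟩
      x * x ^ n   ≈⟨ *-congʳ (x ^ n) x≈0 ⟩
      + 0 * x ^ n ≡⟨ ℤ.*-zeroˡ (x ^ n) ⟩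
      + 0         ∎)
      where open SetoidReasoning ≈-setoid

    *-cancelˡ-≈ : ∀ {x y z} → x ≉ + 0 → x * y ≈ x * z → y ≈ z
    *-cancelˡ-≈ {x} {y} {z} x≉0 (congruent h)
      with x*y≈0⇒x≈0∨y≈0 x (y - z) (∣⇒≈0 (subst (+ p ∣_) (lemma x y z) h))
      where lemma : ∀ x y z → x * y - x * z ≡ x * (y - z)
            lemma = solve-∀
    ... | inj₁ x≈0   = ⊥-elim (x≉0 x≈0)
    ... | inj₂ y-z≈0 = x-y≈0⇒x≈y y-z≈0

    *-cancelʳ-≈ : ∀ {x y z} → z ≉ + 0 → x * z ≈ y * z → x ≈ y
    *-cancelʳ-≈ {x} {y} {z} z≉0 h = *-cancelˡ-≈ z≉0 (subst₂ _≈_ (ℤ.*-comm x z) (ℤ.*-comm y z) h)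

    private instance
      p≢0 : ℕ.NonZero p
      p≢0 = prime⇒nonZero prime

    residue : ℤ → Fin p
    residue x = fromℕ< (n%ℕd<d x p)

    residue-injective : ∀ {x y} → residue x ≡ residue y → x ≈ y
    residue-injective {x} {y} eq = congruent (divides (x /ℕ p - y /ℕ p) (begin
      x - y                                         ≡⟨ cong₂ _-_ (a≡a%ℕn+[a/ℕn]*n x p) y≡r+[y/p]p ⟩
      (+ r + x /ℕ p * + p) - (+ r + y /ℕ p * + p)   ≡⟨ lemma (+ r) (x /ℕ p) (y /ℕ p) (+ p) ⟩
      (x /ℕ p - y /ℕ p) * + p                       ∎))
      where
        open ≡-Reasoning
        r = x %ℕ p
        same-rem : r ≡ y %ℕ p
        same-rem = Fin.fromℕ<-injective _ _ (n%ℕd<d x p) (n%ℕd<d y p) eq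
        y≡r+[y/p]p : y ≡ + r + y /ℕ p * + p
        y≡r+[y/p]p = subst (λ r′ → y ≡ + r′ + y /ℕ p * + p) (sym same-rem) (a≡a%ℕn+[a/ℕn]*n y p)
        lemma : ∀ r a b q → (r + a * q) - (r + b * q) ≡ (a - b) * q
        lemma = solve-∀

    injective-≉0⇒< : ∀ {n} (f : Fin n → ℤ) → Injective _≡_ _≈_ f → (∀ i → f i ≉ + 0) → n < p
    injective-≉0⇒< {n} f f-injective f≉0 = Fin.injective⇒≤ g-injective
      where
        g : Fin (suc n) → Fin p
        g Fin.zero    = residue (+ 0)
        g (Fin.suc i) = residue (f i)
        g-injective : Injective _≡_ _≡_ g
        g-injective {Fin.zero}  {Fin.zero}  _  = refl
        g-injective {Fin.zero}  {Fin.suc j} eq = ⊥-elim (f≉0 j (≈-sym (residue-injective eq)))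
        g-injective {Fin.suc i} {Fin.zero}  eq = ⊥-elim (f≉0 i (residue-injective eq))
        g-injective {Fin.suc i} {Fin.suc j} eq = cong Fin.suc (f-injective (residue-injective eq))

    injective-roots⇒≤ : ∀ {d n} (cs : Vec ℤ d) (f : Fin n → ℤ) → Injective _≡_ _≈_ f →
                        (∀ i → monic cs (f i) ≈ + 0) → n ≤ d
    injective-roots⇒≤ {n = zero}  _          _ _           _     = z≤n
    injective-roots⇒≤ {n = suc n} []         _ _           roots = ⊥-elim (1≉0 (roots Fin.zero))
    injective-roots⇒≤ {n = suc n} cs@(_ ∷ _) f f-injective roots =
      s≤s (injective-roots⇒≤ (deflate r cs) (f ∘ Fin.suc) (Fin.suc-injective ∘ f-injective) deflated-roots)
      where
        r = f Fin.zero
        deflated-roots : ∀ i → monic (deflate r cs) (f (Fin.suc i)) ≈ + 0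
        deflated-roots i with x*y≈0⇒x≈0∨y≈0 (x - r) (monic (deflate r cs) x) factored
          where
            x = f (Fin.suc i)
            factored : (x - r) * monic (deflate r cs) x ≈ + 0
            factored = subst (_≈ + 0) (monic-factor r cs x) (sub-cong (roots (Fin.suc i)) (roots Fin.zero))
        ... | inj₁ x-r≈0 with () ← f-injective (x-y≈0⇒x≈y x-r≈0)
        ... | inj₂ q≈0   = q≈0

    injective-unity-roots⇒≤ : ∀ {k n} (f : Fin n → ℤ) → Injective _≡_ _≈_ f → 1 ≤ k →
                              (∀ i → f i ^ k ≈ + 1) → n ≤ k
    injective-unity-roots⇒≤ {suc d} f f-injective _ unity =
      injective-roots⇒≤ (- + 1 ∷ replicate d (+ 0)) f f-injective roots
      where
        roots : ∀ i → monic (- + 1 ∷ replicate d (+ 0)) (f i) ≈ + 0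
        roots i = subst (λ y → - + 1 + f i * y ≈ + 0) (sym (monic-zeros d (f i)))
                    (+-cong (≈-refl {x = - + 1}) (unity i))

module Monomials {p : ℕ} (prime : Prime p) (ρ β : ℤ) {m : ℕ} (ρ-order : IsMultOrder p ρ m)
                 (β≉0 : Congruence._≉_ p β (+ 0)) where

  open import Data.Integer using (_*_; _^_)
  open IntegerAlgebra

  open Congruence p
  open PrimeModulus prime

  1≤m : 1 ≤ m
  1≤m = proj₁ ρ-order

  ρ^m≈1 : ρ ^ m ≈ + 1
  ρ^m≈1 = ≡[mod]⇒≈ (proj₁ (proj₂ ρ-order))

  ρ^e≈1⇒m≤e : ∀ {e} → 1 ≤ e → ρ ^ e ≈ + 1 → m ≤ e
  ρ^e≈1⇒m≤e 1≤e h = ℕ.≮⇒≥ (λ e<m → proj₂ (proj₂ ρ-order) _ 1≤e e<m (≈⇒≡[mod] h))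

  ρ≉0 : ρ ≉ + 0
  ρ≉0 = x^n≈1⇒x≉0 m 1≤m ρ^m≈1

  ρ^[q*m]≈1 : ∀ q → ρ ^ (q ℕ.* m) ≈ + 1
  ρ^[q*m]≈1 zero    = ≈-refl
  ρ^[q*m]≈1 (suc q) = begin
    ρ ^ (m ℕ.+ q ℕ.* m)     ≡⟨ ℤ.^-distribˡ-+-* ρ m (q ℕ.* m) ⟩
    ρ ^ m * ρ ^ (q ℕ.* m)   ≈⟨ *-cong ρ^m≈1 (ρ^[q*m]≈1 q) ⟩
    + 1                     ∎
    where open SetoidReasoning ≈-setoid

  private instance
    m≢0 : ℕ.NonZero m
    m≢0 = ℕ.>-nonZero 1≤m

  ρ^t≈ρ^[t%m] : ∀ t → ρ ^ t ≈ ρ ^ (t % m)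
  ρ^t≈ρ^[t%m] t = begin
    ρ ^ t                              ≡⟨ cong (ρ ^_) (m≡m%n+[m/n]*n t m) ⟩
    ρ ^ (t % m ℕ.+ t / m ℕ.* m)        ≡⟨ ℤ.^-distribˡ-+-* ρ (t % m) (t / m ℕ.* m) ⟩
    ρ ^ (t % m) * ρ ^ (t / m ℕ.* m)    ≈⟨ *-congˡ (ρ ^ (t % m)) (ρ^[q*m]≈1 (t / m)) ⟩
    ρ ^ (t % m) * + 1                  ≡⟨ ℤ.*-identityʳ _ ⟩
    ρ ^ (t % m)                        ∎
    where open SetoidReasoning ≈-setoid

  ρ^t≈ρ^[t+e]⇒m≤e : ∀ t {e} → 1 ≤ e → ρ ^ t ≈ ρ ^ (t ℕ.+ e) → m ≤ e
  ρ^t≈ρ^[t+e]⇒m≤e t {e} 1≤e h = ρ^e≈1⇒m≤e 1≤e (≈-sym (*-cancelˡ-≈ (^-≉0 t ρ≉0) (begin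
    ρ ^ t * + 1         ≡⟨ ℤ.*-identityʳ _ ⟩
    ρ ^ t               ≈⟨ h ⟩
    ρ ^ (t ℕ.+ e)       ≡⟨ ℤ.^-distribˡ-+-* ρ t e ⟩
    ρ ^ t * ρ ^ e       ∎)))
    where open SetoidReasoning ≈-setoid

  ρ^a≉ρ^b : ∀ {a b} → a < b → b < m → ρ ^ a ≉ ρ ^ b
  ρ^a≉ρ^b {a} {b} a<b b<m h = ℕ.<⇒≱ (ℕ.≤-<-trans (ℕ.m∸n≤m b a) b<m)
    (ρ^t≈ρ^[t+e]⇒m≤e a (ℕ.m<n⇒0<n∸m a<b) (subst (λ c → ρ ^ a ≈ ρ ^ c) (sym a+[b∸a]≡b) h))
    where a+[b∸a]≡b = ℕ.m+[n∸m]≡n (ℕ.<⇒≤ a<b)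

  ρ^-injective : ∀ {t t′} → t < m → t′ < m → ρ ^ t ≈ ρ ^ t′ → t ≡ t′
  ρ^-injective {t} {t′} t<m t′<m h with ℕ.<-cmp t t′
  ... | tri< t<t′ _ _ = ⊥-elim (ρ^a≉ρ^b t<t′ t′<m h)
  ... | tri≈ _ t≡t′ _ = t≡t′
  ... | tri> _ _ t′<t = ⊥-elim (ρ^a≉ρ^b t′<t t<m (≈-sym h))

  mono : ℕ → ℕ → ℤ
  mono j n = ρ ^ j * β ^ n

  mono-+ : ∀ a b c d → mono (a ℕ.+ c) (b ℕ.+ d) ≡ mono a b * mono c d
  mono-+ a b c d = begin
    ρ ^ (a ℕ.+ c) * β ^ (b ℕ.+ d)     ≡⟨ cong₂ _*_ (ℤ.^-distribˡ-+-* ρ a c) (ℤ.^-distribˡ-+-* β b d) ⟩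
    (ρ ^ a * ρ ^ c) * (β ^ b * β ^ d) ≡⟨ interchange (ρ ^ a) (ρ ^ c) (β ^ b) (β ^ d) ⟩
    (ρ ^ a * β ^ b) * (ρ ^ c * β ^ d) ∎
    where open ≡-Reasoning

  mono-≉0 : ∀ j n → mono j n ≉ + 0
  mono-≉0 j n = *-≉0 (^-≉0 j ρ≉0) (^-≉0 n β≉0)

  mono-cancel : ∀ a b {c d c′ d′} →
                mono (a ℕ.+ c) (b ℕ.+ d) ≈ mono (a ℕ.+ c′) (b ℕ.+ d′) → mono c d ≈ mono c′ d′
  mono-cancel a b {c} {d} {c′} {d′} h =
    *-cancelˡ-≈ (mono-≉0 a b) (subst₂ _≈_ (mono-+ a b c d) (mono-+ a b c′ d′) h)

  mono-^ : ∀ {k} → ρ ^ k ≈ + 1 → β ^ k ≈ + 1 → ∀ j n → mono j n ^ k ≈ + 1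
  mono-^ {k} ρ^k≈1 β^k≈1 j n = begin
    (ρ ^ j * β ^ n) ^ k         ≡⟨ ^-distribʳ-* (ρ ^ j) (β ^ n) k ⟩
    (ρ ^ j) ^ k * (β ^ n) ^ k   ≡⟨ cong₂ _*_ (^-^-comm ρ j k) (^-^-comm β n k) ⟩
    (ρ ^ k) ^ j * (β ^ k) ^ n   ≈⟨ *-cong (^-congˡ j ρ^k≈1) (^-congˡ n β^k≈1) ⟩
    (+ 1) ^ j * (+ 1) ^ n       ≡⟨ cong₂ _*_ (ℤ.^-zeroˡ j) (ℤ.^-zeroˡ n) ⟩
    + 1                         ∎
    where open SetoidReasoning ≈-setoid

  mono[m,0]≈1 : mono m 0 ≈ + 1
  mono[m,0]≈1 = subst (_≈ + 1) (sym (ℤ.*-identityʳ (ρ ^ m))) ρ^m≈1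

  -- I_n ≠ ∅ in the coordinates ρ = α/β and β, where α^j β^(n−j) = ρ^j β^n (see α^jβ^[n∸j]≈mono).
  I-nonempty : ℕ → Set
  I-nonempty n = ∃[ j ] (j ≤ n × mono j n ≈ + 1)

  module Separation {k : ℕ} (below-k-empty : ∀ n → 1 ≤ n → n < k → ¬ I-nonempty n)
                    {j0 : ℕ} (j0∈I : mono j0 k ≈ + 1) (j0+m≤k : j0 ℕ.+ m ≤ k) where

    reduced-mono≉1 : ∀ {t d} → t < m → 1 ≤ d → d < k → mono t d ≉ + 1
    reduced-mono≉1 {t} {d} t<m 1≤d d<k h with t ℕ.≤? d
    ... | yes t≤d = below-k-empty d 1≤d d<k (t , t≤d , h)
    -- For t > d, the complement of ρ^t β^d in ρ^(j₀+m) β^k = 1 witnesses I_(k−d) ≠ ∅.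
    ... | no  t≰d = below-k-empty (k ∸ d) (ℕ.m<n⇒0<n∸m d<k) (ℕ.∸-monoʳ-< 1≤d (ℕ.<⇒≤ d<k))
                      (j0 ℕ.+ m ∸ t , u≤v , complement)
      where
        d≤t : d ≤ t
        d≤t = ℕ.<⇒≤ (ℕ.≰⇒> t≰d)
        u≤v : j0 ℕ.+ m ∸ t ≤ k ∸ d
        u≤v = ℕ.≤-trans (ℕ.∸-monoʳ-≤ (j0 ℕ.+ m) d≤t) (ℕ.∸-monoˡ-≤ d j0+m≤k)
        exponents : (j0 ℕ.+ m ∸ t) ℕ.+ t ≡ m ℕ.+ j0
        exponents = trans (ℕ.m∸n+n≡m (ℕ.≤-trans (ℕ.<⇒≤ t<m) (ℕ.m≤n+m m j0))) (ℕ.+-comm j0 m)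
        complement : mono (j0 ℕ.+ m ∸ t) (k ∸ d) ≈ + 1
        complement = begin
          mono u v                            ≡⟨ ℤ.*-identityʳ (mono u v) ⟨
          mono u v * + 1                      ≈⟨ *-congˡ (mono u v) (≈-sym h) ⟩
          mono u v * mono t d                 ≡⟨ mono-+ u v t d ⟨
          mono (u ℕ.+ t) (v ℕ.+ d)            ≡⟨ cong₂ mono exponents (ℕ.m∸n+n≡m (ℕ.<⇒≤ d<k)) ⟩
          mono (m ℕ.+ j0) (0 ℕ.+ k)           ≡⟨ mono-+ m 0 j0 k ⟩
          mono m 0 * mono j0 k                ≈⟨ *-cong mono[m,0]≈1 j0∈I ⟩
          + 1                                 ∎
          where
            open SetoidReasoning ≈-setoid
            u = j0 ℕ.+ m ∸ t
            v = k ∸ d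

    mono≉1 : ∀ t {d} → 1 ≤ d → d < k → mono t d ≉ + 1
    mono≉1 t {d} 1≤d d<k h =
      reduced-mono≉1 (m%n<n t m) 1≤d d<k (≈-trans (*-congʳ (β ^ d) (≈-sym (ρ^t≈ρ^[t%m] t))) h)

    mono-separated : ∀ {t t′ s s′} → t ≤ m → s < s′ → s′ < k → mono t s ≉ mono t′ s′
    mono-separated {t} {t′} {s} {s′} t≤m s<s′ s′<k h =
      mono≉1 (m ∸ t ℕ.+ t′) (ℕ.m<n⇒0<n∸m s<s′) (ℕ.≤-<-trans (ℕ.m∸n≤m s′ s) s′<k) (begin
        mono (m ∸ t ℕ.+ t′) d         ≡⟨ mono-+ (m ∸ t) 0 t′ d ⟩
        mono (m ∸ t) 0 * mono t′ d    ≈⟨ *-congˡ (mono (m ∸ t) 0) (≈-sym shifted) ⟩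
        mono (m ∸ t) 0 * mono t 0     ≡⟨ mono-+ (m ∸ t) 0 t 0 ⟨
        mono (m ∸ t ℕ.+ t) 0          ≡⟨ cong (λ a → mono a 0) (ℕ.m∸n+n≡m t≤m) ⟩
        mono m 0                      ≈⟨ mono[m,0]≈1 ⟩
        + 1                           ∎)
      where
        open SetoidReasoning ≈-setoid
        d = s′ ∸ s
        shifted : mono t 0 ≈ mono t′ d
        shifted = mono-cancel 0 s {t} {0} {t′} {d} (subst₂ (λ a b → mono t a ≈ mono t′ b)
                    (sym (ℕ.+-identityʳ s)) (sym (ℕ.m+[n∸m]≡n (ℕ.<⇒≤ s<s′))) h)

    mono-injective : ∀ {t t′ s s′} → t < m → t′ < m → s < k → s′ < k →
                     mono t s ≈ mono t′ s′ → s ≡ s′ × t ≡ t′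
    mono-injective {t} {t′} {s} {s′} t<m t′<m s<k s′<k h with ℕ.<-cmp s s′
    ... | tri< s<s′ _ _ = ⊥-elim (mono-separated {t′ = t′} (ℕ.<⇒≤ t<m) s<s′ s′<k h)
    ... | tri≈ _ refl _ = refl , ρ^-injective t<m t′<m (*-cancelʳ-≈ (^-≉0 s β≉0) h)
    ... | tri> _ _ s′<s = ⊥-elim (mono-separated {t′ = t} (ℕ.<⇒≤ t′<m) s′<s s<k (≈-sym h))

    coset-element : Fin k × Fin m → ℤ
    coset-element (s , t) = mono (toℕ t) (toℕ s)

    coset-element-injective : Injective _≡_ _≈_ coset-element
    coset-element-injective {s , t} {s′ , t′} h
      with mono-injective (Fin.toℕ<n t) (Fin.toℕ<n t′) (Fin.toℕ<n s) (Fin.toℕ<n s′) h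
    ... | s≡s′ , t≡t′ = cong₂ _,_ (Fin.toℕ-injective s≡s′) (Fin.toℕ-injective t≡t′)

    coset-elements : Fin (k ℕ.* m) → ℤ
    coset-elements = coset-element ∘ Fin.remQuot {k} m

    coset-elements-injective : Injective _≡_ _≈_ coset-elements
    coset-elements-injective {i} {i′} h = begin
      i                                          ≡⟨ Fin.combine-remQuot {k} m i ⟨
      uncurry Fin.combine (Fin.remQuot {k} m i)  ≡⟨ cong (uncurry Fin.combine) (coset-element-injective h) ⟩
      uncurry Fin.combine (Fin.remQuot {k} m i′) ≡⟨ Fin.combine-remQuot {k} m i′ ⟩
      i′                                         ∎
      where open ≡-Reasoning

    k*m<p : k ℕ.* m < p
    k*m<p = injective-≉0⇒< coset-elements coset-elements-injective
              (λ i → let (s , t) = Fin.remQuot {k} m i in mono-≉0 (toℕ t) (toℕ s))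

    k*m≤k : 1 ≤ k → ρ ^ k ≈ + 1 → β ^ k ≈ + 1 → k ℕ.* m ≤ k
    k*m≤k 1≤k ρ^k≈1 β^k≈1 = injective-unity-roots⇒≤ coset-elements coset-elements-injective 1≤k
      (λ i → let (s , t) = Fin.remQuot {k} m i in mono-^ {k} ρ^k≈1 β^k≈1 (toℕ t) (toℕ s))

  module _ {α : ℤ} (ρβ≈α : ρ * β ≈ α) where

    α^jβ^[n∸j]≈mono : ∀ {j n} → j ≤ n → α ^ j * β ^ (n ∸ j) ≈ mono j n
    α^jβ^[n∸j]≈mono {j} {n} j≤n = begin
      α ^ j * β ^ (n ∸ j)             ≈⟨ *-congʳ (β ^ (n ∸ j)) (^-congˡ j (≈-sym ρβ≈α)) ⟩
      (ρ * β) ^ j * β ^ (n ∸ j)       ≡⟨ cong (_* β ^ (n ∸ j)) (^-distribʳ-* ρ β j) ⟩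
      (ρ ^ j * β ^ j) * β ^ (n ∸ j)   ≡⟨ ℤ.*-assoc (ρ ^ j) (β ^ j) (β ^ (n ∸ j)) ⟩
      ρ ^ j * (β ^ j * β ^ (n ∸ j))   ≡⟨ cong (ρ ^ j *_) (ℤ.^-distribˡ-+-* β j (n ∸ j)) ⟨
      ρ ^ j * β ^ (j ℕ.+ (n ∸ j))     ≡⟨ cong (λ e → ρ ^ j * β ^ e) (ℕ.m+[n∸m]≡n j≤n) ⟩
      mono j n                        ∎
      where open SetoidReasoning ≈-setoid

    InI⇒mono≈1 : ∀ {n j} → InI p α β n j → mono j n ≈ + 1
    InI⇒mono≈1 (j≤n , h) = ≈-trans (≈-sym (α^jβ^[n∸j]≈mono j≤n)) (≡[mod]⇒≈ h)

    I-nonempty⇒INonempty : ∀ {n} → I-nonempty n → INonempty p α β n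
    I-nonempty⇒INonempty (j , j≤n , h) = j , j≤n , ≈⇒≡[mod] (≈-trans (α^jβ^[n∸j]≈mono j≤n) h)

  module _ (2≤m : 2 ≤ m) (p≤m*m+1 : p ≤ m ℕ.* m ℕ.+ 1)
           {k : ℕ} (below-k-empty : ∀ n → 1 ≤ n → n < k → ¬ I-nonempty n) where

    I-has-no-two-elements : ∀ {j0 j} → j0 < j → j ≤ k → mono j0 k ≈ + 1 → mono j k ≉ + 1
    I-has-no-two-elements {j0} {j} j0<j j≤k j0∈I j∈I = ℕ.<⇒≱ 2≤m m≤1
      where
        j0+[j∸j0]≡j : j0 ℕ.+ (j ∸ j0) ≡ j
        j0+[j∸j0]≡j = ℕ.m+[n∸m]≡n (ℕ.<⇒≤ j0<j)
        m≤j∸j0 : m ≤ j ∸ j0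
        m≤j∸j0 = ρ^t≈ρ^[t+e]⇒m≤e j0 (ℕ.m<n⇒0<n∸m j0<j) (*-cancelʳ-≈ (^-≉0 k β≉0) (begin
          mono j0 k                   ≈⟨ j0∈I ⟩
          + 1                         ≈⟨ ≈-sym j∈I ⟩
          mono j k                    ≡⟨ cong (λ a → mono a k) j0+[j∸j0]≡j ⟨
          mono (j0 ℕ.+ (j ∸ j0)) k    ∎))
          where open SetoidReasoning ≈-setoid
        j0+m≤k : j0 ℕ.+ m ≤ k
        j0+m≤k = ℕ.≤-trans (ℕ.+-monoʳ-≤ j0 m≤j∸j0) (subst (_≤ k) (sym j0+[j∸j0]≡j) j≤k)
        open Separation below-k-empty j0∈I j0+m≤k
        m≤k : m ≤ k
        m≤k = ℕ.m+n≤o⇒n≤o j0 j0+m≤k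
        k≤m : k ≤ m
        k≤m = ℕ.*-cancelʳ-≤ k m m
                (ℕ.≤-pred (ℕ.≤-trans k*m<p (subst (p ≤_) (ℕ.+-comm (m ℕ.* m) 1) p≤m*m+1)))
        j0≡0 : j0 ≡ 0
        j0≡0 = ℕ.n≤0⇒n≡0 (ℕ.+-cancelʳ-≤ m j0 0 (ℕ.≤-trans j0+m≤k k≤m))
        β^k≈1 : β ^ k ≈ + 1
        β^k≈1 = subst (_≈ + 1) (ℤ.*-identityˡ (β ^ k)) (subst (λ a → mono a k ≈ + 1) j0≡0 j0∈I)
        ρ^k≈1 : ρ ^ k ≈ + 1
        ρ^k≈1 = subst (λ a → ρ ^ a ≈ + 1) (ℕ.≤-antisym m≤k k≤m) ρ^m≈1
        1≤k : 1 ≤ k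
        1≤k = ℕ.≤-trans 1≤m m≤k
        instance
          k≢0 : ℕ.NonZero k
          k≢0 = ℕ.>-nonZero 1≤k
        m≤1 : m ≤ 1
        m≤1 = ℕ.*-cancelˡ-≤ k
                (subst (k ℕ.* m ≤_) (sym (ℕ.*-identityʳ k)) (k*m≤k 1≤k ρ^k≈1 β^k≈1))

    I-subsingleton : ∀ {j j′} → j ≤ k → j′ ≤ k → mono j k ≈ + 1 → mono j′ k ≈ + 1 → j ≡ j′
    I-subsingleton {j} {j′} j≤k j′≤k j∈I j′∈I with ℕ.<-cmp j j′
    ... | tri< j<j′ _ _ = ⊥-elim (I-has-no-two-elements j<j′ j′≤k j∈I j′∈I)
    ... | tri≈ _ j≡j′ _ = j≡j′
    ... | tri> _ _ j′<j = ⊥-elim (I-has-no-two-elements j′<j j≤k j′∈I j∈I)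

module PadovanRoots {p : ℕ} (prime : Prime p) where

  open import Data.Integer using (_+_; _-_; _*_; _^_)
  open Congruence p
  open PrimeModulus prime

  root-≉0 : ∀ {x} → IsRootPadovanPoly p x → x ≉ + 0
  root-≉0 {x} root x≈0 = 1≉0 (begin
    + 1        ≈⟨ +-cong (≈-sym x≈0) (≈-refl {+ 1}) ⟩
    x + + 1    ≈⟨ ≈-sym (≡[mod]⇒≈ root) ⟩
    x ^ 3      ≈⟨ ^-congˡ 3 x≈0 ⟩
    + 0        ∎)
    where open SetoidReasoning ≈-setoid

  -- (β² − 1) β = β³ − β = 1 for a root β, so α (β² − 1) represents α/β.
  root-quotient : ℤ → ℤ → ℤ
  root-quotient α β = α * (β * β - + 1)

  root-quotient-*β≈α : ∀ {β} → IsRootPadovanPoly p β → ∀ α → root-quotient α β * β ≈ α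
  root-quotient-*β≈α {β} root α = congruent-by (lemma α β) (∣n⇒∣m*n α p∣β³-[β+1])
    where
      p∣β³-[β+1] : + p ∣ β ^ 3 - (β + + 1)
      p∣β³-[β+1] = ∣ᵤ⇒∣ root
      lemma : ∀ a b → a * (b * (b * (b * + 1)) - (b + + 1)) ≡ a * (b * b - + 1) * b - a
      lemma = solve-∀

open import Data.Nat using (ℕ; _≤_; _^_; _+_; _⊓_)
open import Data.Nat.Primality using (Prime)
open import Data.Integer using (ℤ; +_) renaming (_+_ to _+ᶻ_; _*_ to _*ᶻ_; _^_ to _^ᶻ_)
open import Relation.Binary.PropositionalEquality using (_≡_)
open import Relation.Nullary using (¬_)

corollary4p5 : (p : ℕ) → Prime p → 5 ≤ p →
    (α β γ : ℤ) →
    IsRootPadovanPoly p α → IsRootPadovanPoly p β → IsRootPadovanPoly p γ →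
    ¬ (α ≡ β [mod p ]) → ¬ (β ≡ γ [mod p ]) → ¬ (γ ≡ α [mod p ]) →
    (ordαβ ordβγ ordγα : ℕ) →
    IsOrderOfQuotient p α β ordαβ →
    IsOrderOfQuotient p β γ ordβγ →
    IsOrderOfQuotient p γ α ordγα →
    (a : ℤ → ℤ) → CompletePadovan p a →
    γ ^ᶻ 2 *ᶻ a (+ 1) +ᶻ γ *ᶻ a (+ 2) +ᶻ + 1 ≡ + 0 [mod p ] →
    p ≤ (ordαβ ⊓ ordβγ ⊓ ordγα) ^ 2 + 1 →
    (kmin : ℕ) → IsKmin p α β kmin →
    (j0 : ℕ) → IsMinOfI p α β kmin j0 →
    ∀ j → InI p α β kmin j → j ≡ j0
corollary4p5 p p-prime 5≤p α β _ _ β-root _ _ _ _ m ordβγ ordγα α/β-order _ _ _ _ _ p≤N²+1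
             k (_ , _ , below-k-empty) j0 (j0∈I , _) j j∈I =
  I-subsingleton 2≤m p≤m*m+1 below-k-empty′ (proj₁ j∈I) (proj₁ j0∈I)
                 (InI⇒mono≈1 ρβ≈α j∈I) (InI⇒mono≈1 ρβ≈α j0∈I)
  where
    open Congruence p
    open PadovanRoots p-prime
    ρβ≈α : root-quotient α β *ᶻ β ≈ α
    ρβ≈α = root-quotient-*β≈α β-root α
    open Monomials p-prime (root-quotient α β) β (α/β-order _ (≈⇒≡[mod] ρβ≈α)) (root-≉0 β-root)
    p≤m*m+1 : p ≤ m ℕ.* m + 1
    p≤m*m+1 = ℕ.≤-trans p≤N²+1 (ℕ.+-monoˡ-≤ 1 (ℕ.≤-trans (ℕ.^-monoˡ-≤ 2 N≤m)
                (ℕ.≤-reflexive (cong (m ℕ.*_) (ℕ.*-identityʳ m)))))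
      where N≤m = ℕ.≤-trans (ℕ.m⊓n≤m (m ⊓ ordβγ) ordγα) (ℕ.m⊓n≤m m ordβγ)
    2≤m : 2 ≤ m
    2≤m = ℕ.≰⇒> λ m≤1 → contradiction
            (ℕ.≤-trans (ℕ.≤-trans 5≤p p≤m*m+1) (ℕ.+-mono-≤ (ℕ.*-mono-≤ m≤1 m≤1) (ℕ.≤-refl {1})))
            λ { (s≤s (s≤s ())) }
    below-k-empty′ : ∀ n → 1 ≤ n → n < k → ¬ I-nonempty n
    below-k-empty′ n 1≤n n<k = below-k-empty n 1≤n n<k ∘ I-nonempty⇒INonempty ρβ≈α
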